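{- Let $n\ge 2$, $d\ge 1$ and $t\ge 0$ be integers, and let $A$ be any deterministic algorithm that correctly solves the sum-exclude-self problem on all inputs $\mathit{In}\in\{0,\ldots,2^d-1\}^n$ in the model of computation described in the context, using at most $t$ bits of working memory. Then $A$ must read at least $nd-t$ bits from $\mathit{In}$ during the second pass (maximized over all inputs), i.e. at least $n-\lfloor t/d\rfloor$ elements of $\mathit{In}$ during the second pass.
   Context: The sum-exclude-self problem: given an array $\mathit{In}=(\mathit{In}[0],\ldots,\mathit{In}[n-1])\in\{0,\ldots,2^d-1\}^n$ of $d$-bit unsigned integers, compute $\mathit{Out}\in\mathbb{Z}^n$ with $\mathit{Out}[i]=\sum_{j\neq i}\mathit{In}[j]$ for all $0\le i<n$. Model of computation: the algorithm reads elements of the read-only input array $\mathit{In}$ (each read retrieves one $d$-bit element) and writes to the output array $\mathit{Out}$, which is write-only: it may write any output cell at any time and may overwrite earlier values, but can never read from $\mathit{Out}$. Between any two read or write operations the algorithm keeps at most $t$ bits of working memory. Arithmetic is over $\mathbb{Z}$ with no overflow. Correctness means that at the end of execution every cell $\mathit{Out}[i]$ holds the correct value. For each output cell, its final write is the last write to that cell during execution. The second pass is the time interval from the earliest final write to any output cell until the end of execution. The number of bits read during the second pass is $d$ times the number of input elements read in that interval; the bound refers to the maximum of this quantity over all inputs. -}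

module Defs where

open import Data.Nat using (ℕ; zero; suc; _+_; _*_; _^_)
open import Data.Integer as ℤ using (ℤ; +_)
open import Data.Fin using (Fin; toℕ; _≟_)
open import Data.Bool using (Bool; true; false; if_then_else_; _∨_)
open import Data.Vec using (Vec)
open import Data.List using (List; []; _∷_)
open import Data.Maybe using (Maybe; just; nothing)
open import Data.Product using (Σ; _×_)
open import Relation.Binary.PropositionalEquality using (_≡_)
open import Relation.Nullary.Decidable using (⌊_⌋; does)

Memory : ℕ → Set
Memory t = Vec Bool t

Input : ℕ → ℕ → Set
Input n d = Fin n → Fin (2 ^ d)

-- The operation chosen by the algorithm in a given memory state.
--  * readOp i δ   : read In[i]; the new memory is δ(In[i])
--  * writeOp j v m : write v to Out[j]; the new memory is m
--  * haltOp        : end of execution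
data Action (n d t : ℕ) : Set where
  readOp  : Fin n → (Fin (2 ^ d) → Memory t) → Action n d t
  writeOp : Fin n → ℤ → Memory t → Action n d t
  haltOp  : Action n d t

-- A deterministic algorithm with at most t bits of working memory:
-- everything it knows between two operations is its t-bit memory.
record Algorithm (n d t : ℕ) : Set where
  field
    init : Memory t
    step : Memory t → Action n d t
open Algorithm public

data Event (n : ℕ) : Set where
  rd : Fin n → Event n
  wr : Fin n → ℤ → Event n

data Runs {n d t : ℕ} (A : Algorithm n d t) (In : Input n d)
          : Memory t → List (Event n) → Set where
  runHalt  : ∀ {m} → step A m ≡ haltOp → Runs A In m []
  runRead  : ∀ {m i δ tr} → step A m ≡ readOp i δ →
             Runs A In (δ (In i)) tr → Runs A In m (rd i ∷ tr)
  runWrite : ∀ {m j v m' tr} → step A m ≡ writeOp j v m' →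
             Runs A In m' tr → Runs A In m (wr j v ∷ tr)

finalValue : ∀ {n} → List (Event n) → Fin n → Maybe ℤ
finalValue [] i = nothing
finalValue (rd _ ∷ tr) i = finalValue tr i
finalValue (wr j v ∷ tr) i with finalValue tr i
... | just w = just w
... | nothing = if does (j ≟ i) then just v else nothing

writtenIn : ∀ {n} → Fin n → List (Event n) → Bool
writtenIn j [] = false
writtenIn j (rd _ ∷ tr) = writtenIn j tr
writtenIn j (wr k _ ∷ tr) = does (k ≟ j) ∨ writtenIn j tr

-- The second pass: the suffix of the trace starting at the earliest
-- final write (a write to a cell that is not written again later).
secondPass : ∀ {n} → List (Event n) → List (Event n)
secondPass [] = []
secondPass (rd i ∷ tr) = secondPass tr
secondPass (wr j v ∷ tr) =
  if writtenIn j tr then secondPass tr else (wr j v ∷ tr)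

readCount : ∀ {n} → List (Event n) → ℕ
readCount [] = 0
readCount (rd _ ∷ tr) = suc (readCount tr)
readCount (wr _ _ ∷ tr) = readCount tr

sumFin : ∀ {k} → (Fin k → ℤ) → ℤ
sumFin {zero} f = + 0
sumFin {suc k} f = f Fin.zero ℤ.+ sumFin (λ j → f (Fin.suc j))
  where import Data.Fin as Fin

sumExcludeSelf : ∀ {n} {d} → Input n d → Fin n → ℤ
sumExcludeSelf In i =
  sumFin (λ j → if does (j ≟ i) then + 0 else + toℕ (In j))

Correct : ∀ {n d t} → Algorithm n d t → Set
Correct {n} {d} A = ∀ (In : Input n d) →
  Σ (List (Event n)) λ tr → Runs A In (init A) tr ×
    (∀ i → finalValue tr i ≡ just (sumExcludeSelf {n} {d} In i))

-- Every final write lies in the second pass, so the second-pass trace fixes the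
-- output, and for n ≥ 2 the output fixes the input: the total S = Σ In satisfies
-- Σᵢ Out[i] = (n - 1) S, and In[i] = S - Out[i].  At the start of the second
-- pass the algorithm knows only its t-bit memory, and afterwards its behaviour
-- is a function of that memory and of the values it reads.  So if no second
-- pass reads more than r elements, the map sending an input to (memory at the
-- start of its second pass, values read during it) is injective, whence
-- 2^(dn) ≤ 2^t · 2^(dr).  Taking r to be the largest second-pass read count
-- over all inputs gives nd ≤ t + dr for the input attaining it.

module Submission where

open import Defs
open import Data.Nat using (ℕ; _*_; _∸_; _≤_; _/_; NonZero)
open import Data.List using (List)
open import Data.Product using (Σ; _×_)

open import Data.Nat using (zero; suc; _+_; _^_; _<_; z≤n; s≤s)
open import Data.Nat.Properties
  using (*-comm; ≮⇒≥; <⇒≱; ^-monoʳ-<; ^-*-assoc; ^-distribˡ-+-*; m^n>0; m≤n+o⇒m∸n≤o;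
         ≤-totalOrder; module ≤-Reasoning)
open import Data.Nat.DivMod using (m*n/n≡m; /-monoˡ-≤; +-distrib-/-∣ʳ)
open import Data.Nat.Divisibility using (n∣m*n)
open import Data.Integer as ℤ using (ℤ; +_)
import Data.Integer.Properties as ℤ
open import Algebra.Properties.AbelianGroup ℤ.+-0-abelianGroup using (∙-cancelˡ; ∙-cancelʳ)
open import Algebra.Properties.CommutativeMonoid.Sum ℤ.+-0-commutativeMonoid
  using (sum; ∑-distrib-+; sum-cong-≗)
open import Data.Fin using (Fin; zero; suc; toℕ; _≟_; fromℕ<; combine; funToFin; finToFun)
open import Data.Fin.Properties
  using (toℕ-injective; funToFin-finToFin; finToFun-funToFin; injective⇒≤; 2↔Bool; *↔×)
open import Data.Bool using (true; false; if_then_else_)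
open import Data.Bool.Properties using (∨-zeroʳ)
open import Data.Vec using (Vec; []; _∷_; lookup; tabulate)
open import Data.Vec.Properties using (∷-injective; tabulate∘lookup; tabulate-cong)
open import Data.List using ([]; _∷_; _++_; allFin)
open import Data.List.Membership.Propositional.Properties using (∈-allFin)
import Data.List.Relation.Unary.All as All
open import Data.List.Extrema ≤-totalOrder using (argmax; f[xs]≤f[argmax])
open import Data.Maybe using (just; nothing; is-just)
open import Data.Maybe.Properties using (just-injective)
open import Data.Product using (_,_; proj₁; proj₂; ∃; map)
open import Data.Product.Properties using (,-injective)
open import Function using (_∘_; _↣_; Injection; mk↣; Injective)
open import Function.Construct.Composition using (_↣-∘_)
open import Function.Construct.Identity using (↣-id)
open import Function.Properties.Inverse using (↔⇒↣; ↔-sym)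
open import Data.Product.Function.NonDependent.Propositional using (_×-↣_)
open import Relation.Binary.PropositionalEquality
  using (_≡_; _≗_; refl; sym; trans; cong; cong₂; subst; module ≡-Reasoning)
open import Relation.Nullary.Decidable using (does; yes; no)

sumFin≡sum : ∀ {k} (f : Fin k → ℤ) → sumFin f ≡ sum f
sumFin≡sum {zero}  f = refl
sumFin≡sum {suc k} f = cong (ℤ._+_ (f zero)) (sumFin≡sum (f ∘ suc))

sum-const : ∀ k (x : ℤ) → sum {k} (λ _ → x) ≡ + k ℤ.* x
sum-const zero    x = sym (ℤ.*-zeroˡ x)
sum-const (suc k) x = trans (cong (ℤ._+_ x) (sum-const k x)) (sym (ℤ.suc-* (+ k) x))

excludedSum : ∀ {k} → (Fin k → ℤ) → Fin k → ℤ
excludedSum f i = sumFin (λ j → if does (j ≟ i) then + 0 else f j)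

excludedSum-+ : ∀ {k} (f : Fin k → ℤ) i → excludedSum f i ℤ.+ f i ≡ sumFin f
excludedSum-+ {suc k} f zero =
  trans (cong (ℤ._+ f zero) (ℤ.+-identityˡ (sumFin (f ∘ suc)))) (ℤ.+-comm _ (f zero))
excludedSum-+ {suc k} f (suc i) =
  trans (ℤ.+-assoc (f zero) _ (f (suc i))) (cong (ℤ._+_ (f zero)) (excludedSum-+ (f ∘ suc) i))

sum-excludedSum : ∀ {k} (f : Fin (suc k) → ℤ) → sum (excludedSum f) ≡ + k ℤ.* sumFin f
sum-excludedSum {k} f = ∙-cancelʳ (sumFin f) _ _ (begin
  sum (excludedSum f) ℤ.+ sumFin f    ≡⟨ cong (ℤ._+_ (sum (excludedSum f))) (sumFin≡sum f) ⟩
  sum (excludedSum f) ℤ.+ sum f       ≡⟨ ∑-distrib-+ (excludedSum f) f ⟨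
  sum (λ i → excludedSum f i ℤ.+ f i) ≡⟨ sum-cong-≗ (excludedSum-+ f) ⟩
  sum {suc k} (λ _ → sumFin f)        ≡⟨ sum-const (suc k) (sumFin f) ⟩
  + suc k ℤ.* sumFin f                ≡⟨ ℤ.suc-* (+ k) (sumFin f) ⟩
  sumFin f ℤ.+ + k ℤ.* sumFin f       ≡⟨ ℤ.+-comm (sumFin f) _ ⟩
  + k ℤ.* sumFin f ℤ.+ sumFin f       ∎)
  where open ≡-Reasoning

excludedSum-injective : ∀ {k} (f g : Fin (suc (suc k)) → ℤ) →
                        excludedSum f ≗ excludedSum g → f ≗ g
excludedSum-injective {k} f g eq i = ∙-cancelˡ (excludedSum f i) (f i) (g i) (begin
  excludedSum f i ℤ.+ f i ≡⟨ excludedSum-+ f i ⟩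
  sumFin f                ≡⟨ totals ⟩
  sumFin g                ≡⟨ excludedSum-+ g i ⟨
  excludedSum g i ℤ.+ g i ≡⟨ cong (ℤ._+ g i) (eq i) ⟨
  excludedSum f i ℤ.+ g i ∎)
  where
  open ≡-Reasoning
  totals : sumFin f ≡ sumFin g
  totals = ℤ.*-cancelˡ-≡ (+ suc k) _ _ (begin
    + suc k ℤ.* sumFin f ≡⟨ sum-excludedSum f ⟨
    sum (excludedSum f)  ≡⟨ sum-cong-≗ eq ⟩
    sum (excludedSum g)  ≡⟨ sum-excludedSum g ⟩
    + suc k ℤ.* sumFin g ∎)

sumExcludeSelf-injective : ∀ {n d} → 2 ≤ n → (I J : Input n d) →
                           (∀ i → sumExcludeSelf {d = d} I i ≡ sumExcludeSelf {d = d} J i) → I ≗ J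
sumExcludeSelf-injective (s≤s (s≤s z≤n)) I J eq i =
  toℕ-injective (ℤ.+-injective (excludedSum-injective (+_ ∘ toℕ ∘ I) (+_ ∘ toℕ ∘ J) eq i))

funToFin-cong : ∀ {m k} {f g : Fin m → Fin k} → f ≗ g → funToFin f ≡ funToFin g
funToFin-cong {zero}  _   = refl
funToFin-cong {suc m} f≗g = cong₂ combine (f≗g zero) (funToFin-cong (f≗g ∘ suc))

funToFin-injective : ∀ {m k} {f g : Fin m → Fin k} → funToFin f ≡ funToFin g → f ≗ g
funToFin-injective {f = f} {g} eq i = begin
  f i                        ≡⟨ finToFun-funToFin f i ⟨
  finToFun (funToFin f) i    ≡⟨ cong (λ x → finToFun x i) eq ⟩
  finToFun (funToFin g) i    ≡⟨ finToFun-funToFin g i ⟩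
  g i                        ∎
  where open ≡-Reasoning

finToFun-injective : ∀ {m k} {x y : Fin (k ^ m)} → finToFun {k} {m} x ≗ finToFun y → x ≡ y
finToFun-injective {m} {k} {x} {y} eq =
  trans (sym (funToFin-finToFin {m} {k} x)) (trans (funToFin-cong eq) (funToFin-finToFin {m} {k} y))

vec↣ : ∀ {A : Set} {k r} → A ↣ Fin k → Vec A r ↣ Fin (k ^ r)
vec↣ {A} {k} {r} c = mk↣ injective
  where
  code : Vec A r → Fin (k ^ r)
  code u = funToFin (Injection.to c ∘ lookup u)
  injective : Injective _≡_ _≡_ code
  injective {u} {v} eq = begin
    u                   ≡⟨ tabulate∘lookup u ⟨
    tabulate (lookup u) ≡⟨ tabulate-cong (Injection.injective c ∘ funToFin-injective eq) ⟩
    tabulate (lookup v) ≡⟨ tabulate∘lookup v ⟩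
    v                   ∎
    where open ≡-Reasoning

^-cancelˡ-≤ : ∀ m {a b} → 1 < m → m ^ a ≤ m ^ b → a ≤ b
^-cancelˡ-≤ m 1<m le = ≮⇒≥ (λ b<a → <⇒≱ (^-monoʳ-< m 1<m b<a) le)

m*n≤o+m*p⇒n∸o/m≤p : ∀ m n o p .{{_ : NonZero m}} → m * n ≤ o + m * p → n ∸ o / m ≤ p
m*n≤o+m*p⇒n∸o/m≤p m n o p le = m≤n+o⇒m∸n≤o n (o / m) (begin
  n                 ≡⟨ m*n/n≡m n m ⟨
  n * m / m         ≡⟨ cong (_/ m) (*-comm n m) ⟩
  m * n / m         ≤⟨ /-monoˡ-≤ m le ⟩
  (o + m * p) / m   ≡⟨ cong (λ x → (o + x) / m) (*-comm m p) ⟩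
  (o + p * m) / m   ≡⟨ +-distrib-/-∣ʳ o (n∣m*n p) ⟩
  o / m + p * m / m ≡⟨ cong (_+_ (o / m)) (m*n/n≡m p m) ⟩
  o / m + p         ∎)
  where open ≤-Reasoning

writtenIn≡is-just∘finalValue : ∀ {n} (j : Fin n) tr → writtenIn j tr ≡ is-just (finalValue tr j)
writtenIn≡is-just∘finalValue j []            = refl
writtenIn≡is-just∘finalValue j (rd _ ∷ tr)   = writtenIn≡is-just∘finalValue j tr
writtenIn≡is-just∘finalValue j (wr k v ∷ tr)
  rewrite writtenIn≡is-just∘finalValue j tr with finalValue tr j
... | just _  = ∨-zeroʳ (does (k ≟ j))
... | nothing with does (k ≟ j)
...   | true  = refl
...   | false = refl

finalValue-overwritten : ∀ {n} {j : Fin n} {v} tr i → writtenIn j tr ≡ true →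
                         finalValue (wr j v ∷ tr) i ≡ finalValue tr i
finalValue-overwritten {j = j} tr i written with finalValue tr i in fv
... | just _  = refl
... | nothing with j ≟ i
...   | no _     = refl
...   | yes refl
  with () ← trans (sym written) (trans (writtenIn≡is-just∘finalValue j tr) (cong is-just fv))

finalValue-secondPass : ∀ {n} (tr : List (Event n)) i → finalValue (secondPass tr) i ≡ finalValue tr i
finalValue-secondPass []            i = refl
finalValue-secondPass (rd _ ∷ tr)   i = finalValue-secondPass tr i
finalValue-secondPass (wr j v ∷ tr) i with writtenIn j tr in written
... | true  = trans (finalValue-secondPass tr i) (sym (finalValue-overwritten tr i written))
... | false = refl

secondPass-suffix : ∀ {n} (tr : List (Event n)) → ∃ λ pre → pre ++ secondPass tr ≡ tr
secondPass-suffix []            = [] , refl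
secondPass-suffix (rd i ∷ tr)   = map (rd i ∷_) (cong (rd i ∷_)) (secondPass-suffix tr)
secondPass-suffix (wr j v ∷ tr) with writtenIn j tr
... | true  = map (wr j v ∷_) (cong (wr j v ∷_)) (secondPass-suffix tr)
... | false = [] , refl

readValues : ∀ {n} {X : Set} → (Fin n → X) → List (Event n) → List X
readValues In []            = []
readValues In (rd i ∷ tr)   = In i ∷ readValues In tr
readValues In (wr _ _ ∷ tr) = readValues In tr

padTo : ∀ {X : Set} → X → (r : ℕ) → List X → Vec X r
padTo x zero    _        = []
padTo x (suc r) []       = x ∷ padTo x r []
padTo x (suc r) (y ∷ ys) = y ∷ padTo x r ys

module _ {n d t} {A : Algorithm n d t} where

  runs-suffix : ∀ {In m suf} pre → Runs A In m (pre ++ suf) → ∃ λ m′ → Runs A In m′ suf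
  runs-suffix []             run              = _ , run
  runs-suffix (rd _ ∷ pre)   (runRead _ run)  = runs-suffix pre run
  runs-suffix (wr _ _ ∷ pre) (runWrite _ run) = runs-suffix pre run

  runs-secondPass : ∀ {In m tr} → Runs A In m tr → ∃ λ m′ → Runs A In m′ (secondPass tr)
  runs-secondPass {In} {m} {tr} run with secondPass-suffix tr
  ... | pre , eq = runs-suffix pre (subst (Runs A In m) (sym eq) run)

  -- Two runs from the same memory perform the same operations until they read
  -- different values, so the padding is never compared with an actual read.
  runs-deterministic : ∀ {I J : Input n d} (z : Fin (2 ^ d)) r {m tr₁ tr₂} →
                       Runs A I m tr₁ → Runs A J m tr₂ →
                       readCount tr₁ ≤ r → readCount tr₂ ≤ r →
                       padTo z r (readValues I tr₁) ≡ padTo z r (readValues J tr₂) → tr₁ ≡ tr₂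
  runs-deterministic z r (runHalt _)     (runHalt _)     _ _ _ = refl
  runs-deterministic z r (runHalt e₁)    (runRead e₂ _)  _ _ _ with () ← trans (sym e₁) e₂
  runs-deterministic z r (runHalt e₁)    (runWrite e₂ _) _ _ _ with () ← trans (sym e₁) e₂
  runs-deterministic z r (runRead e₁ _)  (runHalt e₂)    _ _ _ with () ← trans (sym e₁) e₂
  runs-deterministic z r (runRead e₁ _)  (runWrite e₂ _) _ _ _ with () ← trans (sym e₁) e₂
  runs-deterministic z r (runWrite e₁ _) (runHalt e₂)    _ _ _ with () ← trans (sym e₁) e₂
  runs-deterministic z r (runWrite e₁ _) (runRead e₂ _)  _ _ _ with () ← trans (sym e₁) e₂
  runs-deterministic {J = J} z (suc r) (runRead {i = i} {δ} e₁ run₁) (runRead e₂ run₂)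
                     (s≤s l₁) (s≤s l₂) eq
    with refl ← trans (sym e₁) e₂ | same-value , same-rest ← ∷-injective eq =
    cong (rd i ∷_) (runs-deterministic z r run₁
                     (subst (λ x → Runs A J (δ x) _) (sym same-value) run₂) l₁ l₂ same-rest)
  runs-deterministic z r (runWrite e₁ run₁) (runWrite e₂ run₂) l₁ l₂ eq
    with refl ← trans (sym e₁) e₂ =
    cong (_ ∷_) (runs-deterministic z r run₁ run₂ l₁ l₂ eq)

module SecondPass {n d t} (A : Algorithm n d t) (correct : Correct A) where

  trace : Input n d → List (Event n)
  trace In = proj₁ (correct In)

  run : ∀ In → Runs A In (init A) (trace In)
  run In = proj₁ (proj₂ (correct In))

  secondPassReads : Input n d → ℕ
  secondPassReads In = readCount (secondPass (trace In))

  secondPassStart : Input n d → Memory t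
  secondPassStart In = proj₁ (runs-secondPass (run In))

  secondPassRun : ∀ In → Runs A In (secondPassStart In) (secondPass (trace In))
  secondPassRun In = proj₂ (runs-secondPass (run In))

  secondPass-determines-input : 2 ≤ n → ∀ I J → secondPass (trace I) ≡ secondPass (trace J) → I ≗ J
  secondPass-determines-input 2≤n I J eq =
    sumExcludeSelf-injective {d = d} 2≤n I J λ i → just-injective (begin
      just (sumExcludeSelf {d = d} I i)   ≡⟨ proj₂ (proj₂ (correct I)) i ⟨
      finalValue (trace I) i              ≡⟨ finalValue-secondPass (trace I) i ⟨
      finalValue (secondPass (trace I)) i ≡⟨ cong (λ tr → finalValue tr i) eq ⟩
      finalValue (secondPass (trace J)) i ≡⟨ finalValue-secondPass (trace J) i ⟩
      finalValue (trace J) i              ≡⟨ proj₂ (proj₂ (correct J)) i ⟩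
      just (sumExcludeSelf {d = d} J i)   ∎)
    where open ≡-Reasoning

  padding : Fin (2 ^ d)
  padding = fromℕ< (m^n>0 2 d)

  secondPassValues : (r : ℕ) → Input n d → Vec (Fin (2 ^ d)) r
  secondPassValues r In = padTo padding r (readValues In (secondPass (trace In)))

  summary : (r : ℕ) → Input n d → Memory t × Vec (Fin (2 ^ d)) r
  summary r In = secondPassStart In , secondPassValues r In

  summary↣ : ∀ r → (Memory t × Vec (Fin (2 ^ d)) r) ↣ Fin (2 ^ t * (2 ^ d) ^ r)
  summary↣ r = ↔⇒↣ (↔-sym *↔×) ↣-∘ (vec↣ (↔⇒↣ (↔-sym 2↔Bool)) ×-↣ vec↣ (↣-id _))

  summary-injective : 2 ≤ n → ∀ r → (∀ x → secondPassReads (finToFun x) ≤ r) →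
                      Injective _≡_ _≡_ (summary r ∘ finToFun)
  summary-injective 2≤n r bounded {x} {y} eq =
    finToFun-injective {n} {2 ^ d} (secondPass-determines-input 2≤n I J
      (runs-deterministic padding r (secondPassRun I) run-J (bounded x) (bounded y) same-values))
    where
    I J : Input n d
    I = finToFun x
    J = finToFun y
    same-values : secondPassValues r I ≡ secondPassValues r J
    same-values = proj₂ (,-injective eq)
    run-J : Runs A J (secondPassStart I) (secondPass (trace J))
    run-J = subst (λ m → Runs A J m (secondPass (trace J)))
                  (sym (proj₁ (,-injective eq))) (secondPassRun J)

  secondPassReads-bound : 2 ≤ n → ∀ r → (∀ x → secondPassReads (finToFun x) ≤ r) → d * n ≤ t + d * r
  secondPassReads-bound 2≤n r bounded = ^-cancelˡ-≤ 2 (s≤s (s≤s z≤n)) (begin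
    2 ^ (d * n)           ≡⟨ ^-*-assoc 2 d n ⟨
    (2 ^ d) ^ n           ≤⟨ injective⇒≤ (Injection.injective code) ⟩
    2 ^ t * (2 ^ d) ^ r   ≡⟨ cong (2 ^ t *_) (^-*-assoc 2 d r) ⟩
    2 ^ t * 2 ^ (d * r)   ≡⟨ ^-distribˡ-+-* 2 t (d * r) ⟨
    2 ^ (t + d * r)       ∎)
    where
    open ≤-Reasoning
    code : Fin ((2 ^ d) ^ n) ↣ Fin (2 ^ t * (2 ^ d) ^ r)
    code = summary↣ r ↣-∘ mk↣ (summary-injective 2≤n r bounded)

theorem3 : (n d t : ℕ) → 2 ≤ n → .{{_ : NonZero d}} →
    (A : Algorithm n d t) → Correct A →
    Σ (Input n d) λ In → Σ (List (Event n)) λ tr →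
      Runs A In (init A) tr ×
      (n * d ∸ t ≤ d * readCount (secondPass tr) ×
       n ∸ (t / d) ≤ readCount (secondPass tr))
theorem3 n d t 2≤n A correct =
  In* , trace In* , run In* ,
  m≤n+o⇒m∸n≤o (n * d) t (subst (_≤ t + d * r) (*-comm d n) bound) ,
  m*n≤o+m*p⇒n∸o/m≤p d n t r bound
  where
  open SecondPass A correct
  reads : Fin ((2 ^ d) ^ n) → ℕ
  reads = secondPassReads ∘ finToFun
  x* : Fin ((2 ^ d) ^ n)
  x* = argmax reads (funToFin {n} (λ _ → padding)) (allFin _)
  In* : Input n d
  In* = finToFun x*
  r : ℕ
  r = secondPassReads In*
  bound : d * n ≤ t + d * r
  bound = secondPassReads-bound 2≤n r λ x → All.lookup (f[xs]≤f[argmax] _ (allFin _)) (∈-allFin x)
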